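{- The SPT-available rule does not give an $\alpha$-approximation for $P|\textit{partition}|\sum_j C_j$ for any $\alpha<\tfrac43$: for every $\alpha<\tfrac43$ there is an instance on which the schedule produced by the SPT-available rule has total completion time larger than $\alpha$ times the optimal total completion time.
   Context: An instance of $P|\textit{partition}|\sum_j C_j$ consists of $m\ge 1$ identical parallel machines, a finite set $J$ of jobs with processing times $p_j>0$, and a partition $R$ of $J$ into classes called resources; two jobs in the same class share a resource. A schedule assigns to each job $j$ one machine and a start time $S_j\ge0$; $j$ is processed without interruption on that machine during $[S_j,C_j)$ with $C_j=S_j+p_j$. It is feasible if the processing intervals of distinct jobs on the same machine are disjoint and the processing intervals of distinct jobs sharing a resource are disjoint; the objective is to minimize $\sum_j C_j$. The SPT-available rule builds a schedule from a list containing all jobs ordered from shortest to largest processing time (ties broken arbitrarily). At any point in time at which a machine is available (idle), the rule selects the first job in the list whose resource is not currently in use by a job being processed, starts it, and removes it from the list. If multiple machines are available at time $t$ and the selected job's resource was in use just before time $t$, the job is put on the machine that was previously using this resource; otherwise an arbitrary available machine is chosen. If the resources of all jobs remaining on the list are in use, no job is started. -}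

module Defs where

open import Data.Nat using (ℕ)
import Data.Nat as ℕ
open import Data.Fin using (Fin)
open import Data.Rational using (ℚ; 0ℚ; _+_; _≤_; _<_)
open import Data.List using (List; []; _∷_; map; foldr; allFin)
open import Data.List.Membership.Propositional using (_∈_)
open import Data.List.Relation.Unary.All using (All)
open import Data.List.Relation.Unary.AllPairs using (AllPairs)
open import Data.List.Relation.Binary.Permutation.Propositional using (_↭_)
open import Data.Product using (Σ; ∃; _×_; _,_)
open import Data.Sum using (_⊎_)
open import Relation.Nullary using (¬_)
open import Relation.Binary.PropositionalEquality using (_≡_; _≢_)
open import Relation.Binary.Construct.Closure.ReflexiveTransitive using (Star)

-- Instances of P | partition | Σ C_j
-- Jobs are Fin n; machines are Fin m (m ≥ 1); the partition of the jobs
-- into resources is given by a labelling res : Fin n → ℕ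
-- (two jobs share a resource iff they have the same label).

record Instance : Set where
  field
    m     : ℕ
    m≥1   : 1 ℕ.≤ m
    n     : ℕ
    p     : Fin n → ℚ
    p-pos : ∀ j → 0ℚ < p j
    res   : Fin n → ℕ

open Instance public

record Schedule (I : Instance) : Set where
  constructor mkSchedule
  field
    mach  : Fin (n I) → Fin (m I)
    start : Fin (n I) → ℚ

open Schedule public

module _ {I : Instance} (S : Schedule I) where

  C : Fin (n I) → ℚ
  C j = start S j + p I j

  Feasible : Set
  Feasible =
    (∀ j → 0ℚ ≤ start S j) ×
    (∀ j k → j ≢ k → mach S j ≡ mach S k → C j ≤ start S k ⊎ C k ≤ start S j) ×
    (∀ j k → j ≢ k → res I j ≡ res I k → C j ≤ start S k ⊎ C k ≤ start S j)

  cost : ℚ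
  cost = foldr _+_ 0ℚ (map C (allFin (n I)))

  -- The SPT-available rule, as a (nondeterministic) simulation whose
  -- start decisions must agree with the schedule S.
  -- A state is (current time t, remaining list L, list D of started jobs).

  Running : Fin (n I) → ℚ → Set
  Running k t = start S k ≤ t × t < C k

  MachineIdle : List (Fin (n I)) → ℚ → Fin (m I) → Set
  MachineIdle D t i = ∀ k → k ∈ D → mach S k ≡ i → ¬ Running k t

  ResourceFree : List (Fin (n I)) → ℚ → Fin (n I) → Set
  ResourceFree D t j = ∀ k → k ∈ D → res I k ≡ res I j → ¬ Running k t

  -- FirstFree D t L j L' : j is the first job of L whose resource is not in
  -- use at time t, and L' is L with j removed.
  data FirstFree (D : List (Fin (n I))) (t : ℚ) :
       List (Fin (n I)) → Fin (n I) → List (Fin (n I)) → Set where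
    here  : ∀ {j L} → ResourceFree D t j → FirstFree D t (j ∷ L) j L
    there : ∀ {k j L L'} → ¬ ResourceFree D t k → FirstFree D t L j L' →
            FirstFree D t (k ∷ L) j (k ∷ L')

  -- machine choice: an available machine; if the resource of j was in use
  -- just before t (by a job k finishing at t) and k's machine is available,
  -- then j goes on k's machine.
  ValidMachine : List (Fin (n I)) → ℚ → Fin (n I) → Fin (m I) → Set
  ValidMachine D t j i =
    MachineIdle D t i ×
    (∀ k → k ∈ D → res I k ≡ res I j → C k ≡ t → MachineIdle D t (mach S k) →
       i ≡ mach S k)

  NoStart : List (Fin (n I)) → ℚ → List (Fin (n I)) → Set
  NoStart D t L = (∀ i → ¬ MachineIdle D t i) ⊎ All (λ k → ¬ ResourceFree D t k) L

  State : Set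
  State = ℚ × List (Fin (n I)) × List (Fin (n I))

  data Step : State → State → Set where
    startJob : ∀ {t L D j L' i} → FirstFree D t L j L' → ValidMachine D t j i →
               start S j ≡ t → mach S j ≡ i →
               Step (t , L , D) (t , L' , j ∷ D)
    -- nothing can be started: advance to the next completion time
    advance : ∀ {t t' k L D} → L ≢ [] → NoStart D t L → t < t' →
              k ∈ D → C k ≡ t' →
              (∀ l → l ∈ D → C l ≤ t ⊎ t' ≤ C l) →
              Step (t , L , D) (t' , L , D)

  -- S is a schedule produced by the SPT-available rule for some SPT list
  -- (ties broken arbitrarily) and some admissible machine choices.
  SPTAvailable : Set
  SPTAvailable =
    Σ (List (Fin (n I))) λ L₀ →
      (L₀ ↭ allFin (n I)) ×
      AllPairs (λ a b → p I a ≤ p I b) L₀ ×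
      ∃ λ t → ∃ λ D → Star Step (0ℚ , L₀ , []) (t , [] , D)

module Submission where

-- For r ≥ 0 take three machines and 12r unit jobs: r blocks of six jobs, each job with a
-- private resource, followed by a chain of 6r jobs that all share one resource.  Listing the
-- jobs by index (a valid SPT list, since all processing times are equal), the rule packs every
-- block into two time units on the three machines, so the chain only starts at time 2r and is
-- then processed one job at a time: total completion time 36r² + 6r.  Processing the chain on
-- machine 0 from time 0 and each block on machines 1 and 2 in three time units is feasible and
-- costs 27r² + 6r.  The ratio (36r + 6)/(27r + 6) increases to 4/3, and for α = k/d < 4/3 the
-- choice r = d already beats α.

module SPTLowerBound where

  open import Defs
  open import Data.Nat as ℕ using (ℕ; zero; suc; z≤n; s≤s; _+_; _*_; _≤_; _<_)
  import Data.Nat.Properties as ℕP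
  open import Data.Nat.Tactic.RingSolver using (solve-∀)
  open import Data.Integer as ℤ using (+_; -[1+_])
  import Data.Integer.Properties as ℤP
  open import Data.Rational as ℚ using (ℚ; mkℚ; 0ℚ; _/_)
  import Data.Rational.Properties as ℚP
  import Data.Rational.Unnormalised as ℚᵘ
  import Data.Rational.Unnormalised.Properties as ℚᵘP
  import Data.Nat.Coprimality as Coprime
  open import Data.Fin as F using (Fin; toℕ)
  open import Data.Fin.Patterns using (0F; 1F; 2F; 3F; 4F; 5F)
  import Data.Fin.Properties as FP
  open import Data.List using (List; []; _∷_; foldr; tabulate; allFin)
  import Data.List.Properties as LP
  open import Data.List.Membership.Propositional using (_∈_)
  open import Data.List.Relation.Unary.Any using (here; there)
  open import Data.List.Relation.Unary.All as All using (All; []; _∷_)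
  open import Data.List.Relation.Unary.AllPairs using (AllPairs; []; _∷_)
  open import Data.List.Relation.Binary.Permutation.Propositional using (↭-refl)
  open import Data.Product using (∃; ∃₂; _×_; _,_)
  open import Data.Sum using (_⊎_; inj₁; inj₂)
  open import Data.Empty using (⊥-elim)
  open import Relation.Nullary using (¬_; yes; no)
  open import Relation.Nullary.Decidable using (True; toWitness; ¬?; _→-dec_)
  open import Relation.Unary using (Decidable)
  open import Relation.Binary.PropositionalEquality
  open import Relation.Binary.Definitions using (tri<; tri≈; tri>)
  open import Relation.Binary.Construct.Closure.ReflexiveTransitive using (Star; ε; _◅_)

  ∑ : ℕ → (ℕ → ℕ) → ℕ
  ∑ zero    f = 0
  ∑ (suc n) f = f 0 + ∑ n (λ i → f (suc i))

  ∑-cong : ∀ n {f g : ℕ → ℕ} → (∀ i → i < n → f i ≡ g i) → ∑ n f ≡ ∑ n g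
  ∑-cong zero    f≗g = refl
  ∑-cong (suc n) f≗g =
    cong₂ _+_ (f≗g 0 (s≤s z≤n)) (∑-cong n (λ i i<n → f≗g (suc i) (s≤s i<n)))

  ∑-split : ∀ a m f → ∑ (a + m) f ≡ ∑ a f + ∑ m (λ i → f (a + i))
  ∑-split zero    m f = refl
  ∑-split (suc a) m f =
    trans (cong (λ s → f 0 + s) (∑-split a m (λ i → f (suc i)))) (sym (ℕP.+-assoc (f 0) _ _))

  ∑-blocks : ∀ r k f → ∑ (r * k) f ≡ ∑ r (λ b → ∑ k (λ j → f (b * k + j)))
  ∑-blocks zero    k f = refl
  ∑-blocks (suc r) k f = begin
    ∑ (k + r * k) f
      ≡⟨ ∑-split k (r * k) f ⟩
    ∑ k f + ∑ (r * k) (λ i → f (k + i))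
      ≡⟨ cong (λ s → ∑ k f + s) (∑-blocks r k (λ i → f (k + i))) ⟩
    ∑ k f + ∑ r (λ b → ∑ k (λ j → f (k + (b * k + j))))
      ≡⟨ cong (λ s → ∑ k f + s) (∑-cong r (λ b _ → ∑-cong k (λ j _ →
           cong f (sym (ℕP.+-assoc k (b * k) j))))) ⟩
    ∑ k f + ∑ r (λ b → ∑ k (λ j → f (suc b * k + j))) ∎
    where open ≡-Reasoning

  -- Gauss: twice an arithmetic progression, stated without subtraction.
  ∑-arith : ∀ n a d → 2 * ∑ n (λ i → a + d * i) + n * d ≡ n * (2 * a + n * d)
  ∑-arith zero    a d = refl
  ∑-arith (suc n) a d = begin
    2 * (a + d * 0 + S) + suc n * d   ≡⟨ unfold a d n S ⟩
    2 * a + d + (2 * S + n * d)       ≡⟨ cong (λ s → 2 * a + d + (2 * s + n * d)) shift ⟩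
    2 * a + d + (2 * ∑ n (λ i → (a + d) + d * i) + n * d)
                                      ≡⟨ cong (λ s → 2 * a + d + s) (∑-arith n (a + d) d) ⟩
    2 * a + d + n * (2 * (a + d) + n * d)
                                      ≡⟨ fold a d n ⟩
    suc n * (2 * a + suc n * d)       ∎
    where
    open ≡-Reasoning
    S : ℕ
    S = ∑ n (λ i → a + d * suc i)
    step : ∀ a d i → a + d * suc i ≡ (a + d) + d * i
    step = solve-∀
    shift : S ≡ ∑ n (λ i → (a + d) + d * i)
    shift = ∑-cong n (λ i _ → step a d i)
    unfold : ∀ a d n S → 2 * (a + d * 0 + S) + suc n * d ≡ 2 * a + d + (2 * S + n * d)
    unfold = solve-∀
    fold : ∀ a d n → 2 * a + d + n * (2 * (a + d) + n * d) ≡ suc n * (2 * a + suc n * d)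
    fold = solve-∀

  -- Natural numbers as rationals: all start and completion times of the construction are integral.
  fromℕ : ℕ → ℚ
  fromℕ n = mkℚ (+ n) 0 (Coprime.sym (Coprime.1-coprimeTo n))

  private
    *1 : ∀ a → + a ℤ.* + 1 ≡ + a
    *1 a = ℤP.*-identityʳ (+ a)

  fromℕ-mono-≤ : ∀ {a b} → a ≤ b → fromℕ a ℚ.≤ fromℕ b
  fromℕ-mono-≤ {a} {b} a≤b = ℚ.*≤* (subst₂ ℤ._≤_ (sym (*1 a)) (sym (*1 b)) (ℤ.+≤+ a≤b))

  fromℕ-mono-< : ∀ {a b} → a < b → fromℕ a ℚ.< fromℕ b
  fromℕ-mono-< {a} {b} a<b = ℚ.*<* (subst₂ ℤ._<_ (sym (*1 a)) (sym (*1 b)) (ℤ.+<+ a<b))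

  fromℕ-cancel-< : ∀ {a b} → fromℕ a ℚ.< fromℕ b → a < b
  fromℕ-cancel-< {a} {b} (ℚ.*<* a<b) = ℤP.drop‿+<+ (subst₂ ℤ._<_ (*1 a) (*1 b) a<b)

  fromℕ-+ : ∀ a b → fromℕ (a + b) ≡ fromℕ a ℚ.+ fromℕ b
  fromℕ-+ a b = ℚP.toℚᵘ-injective
    (ℚᵘP.≃-sym (ℚᵘP.≃-trans (ℚP.toℚᵘ-homo-+ (fromℕ a) (fromℕ b)) (ℚᵘ.*≡* numerators)))
    where
    open ≡-Reasoning
    numerators : (+ a ℤ.* + 1 ℤ.+ + b ℤ.* + 1) ℤ.* + 1 ≡ + (a + b) ℤ.* + 1
    numerators = begin
      (+ a ℤ.* + 1 ℤ.+ + b ℤ.* + 1) ℤ.* + 1 ≡⟨ ℤP.*-identityʳ _ ⟩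
      + a ℤ.* + 1 ℤ.+ + b ℤ.* + 1           ≡⟨ cong₂ ℤ._+_ (*1 a) (*1 b) ⟩
      + a ℤ.+ + b                           ≡⟨ ℤP.pos-+ a b ⟨
      + (a + b)                             ≡⟨ *1 (a + b) ⟨
      + (a + b) ℤ.* + 1                     ∎

  foldr-fromℕ : ∀ n (g : Fin n → ℚ) (f : ℕ → ℕ) → (∀ i → g i ≡ fromℕ (f (toℕ i))) →
                foldr ℚ._+_ 0ℚ (tabulate g) ≡ fromℕ (∑ n f)
  foldr-fromℕ zero    g f g≗f = refl
  foldr-fromℕ (suc n) g f g≗f = begin
    g F.zero ℚ.+ foldr ℚ._+_ 0ℚ (tabulate (λ i → g (F.suc i)))
      ≡⟨ cong₂ ℚ._+_ (g≗f F.zero)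
               (foldr-fromℕ n (λ i → g (F.suc i)) (λ i → f (suc i)) (λ i → g≗f (F.suc i))) ⟩
    fromℕ (f 0) ℚ.+ fromℕ (∑ n (λ i → f (suc i)))
      ≡⟨ fromℕ-+ (f 0) _ ⟨
    fromℕ (∑ (suc n) f) ∎
    where open ≡-Reasoning

  sptTotal optTotal : ℕ → ℕ
  sptTotal r = 36 * r * r + 6 * r
  optTotal r = 27 * r * r + 6 * r

  ratio-ℕ : ∀ k d → 3 * k < 4 * d → k * optTotal d < sptTotal d * d
  ratio-ℕ k d@(suc d′) 3k<4d =
    ℕP.*-cancelˡ-< 3 _ _ (ℕP.+-cancelʳ-< (6 * d * d) _ _ (begin-strict
      3 * (k * X) + 6 * d * d          <⟨ ℕP.+-monoʳ-< (3 * (k * X)) 6dd<X ⟩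
      3 * (k * X) + X                  ≡⟨ regroup k X ⟩
      suc (3 * k) * X                  ≤⟨ ℕP.*-monoˡ-≤ X 3k<4d ⟩
      4 * d * X                        ≡⟨ expand d ⟩
      3 * (sptTotal d * d) + 6 * d * d ∎))
    where
    open ℕP.≤-Reasoning
    X : ℕ
    X = optTotal d
    split : ∀ e → 6 * suc e * suc e + suc (21 * suc e * suc e + 6 * e + 5)
                ≡ 27 * suc e * suc e + 6 * suc e
    split = solve-∀
    6dd<X : 6 * d * d < X
    6dd<X = subst (6 * d * d <_) (split d′) (ℕP.m<m+n (6 * d * d) (s≤s z≤n))
    regroup : ∀ k X → 3 * (k * X) + X ≡ suc (3 * k) * X
    regroup = solve-∀
    expand : ∀ d → 4 * d * (27 * d * d + 6 * d) ≡ 3 * ((36 * d * d + 6 * d) * d) + 6 * d * d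
    expand = solve-∀

  scale-< : ∀ α a b → (ℚ.↥ α ℤ.* + a) ℤ.* + 1 ℤ.< + b ℤ.* + (ℚ.↧ₙ α ℕ.* 1) →
            α ℚ.* fromℕ a ℚ.< fromℕ b
  scale-< α@(mkℚ _ _ _) a b cross =
    ℚP.toℚᵘ-cancel-< (ℚᵘP.<-respˡ-≃ (ℚᵘP.≃-sym (ℚP.toℚᵘ-homo-* α (fromℕ a))) (ℚᵘ.*<* cross))

  below-4/3 : ∀ α → α ℚ.< + 4 / 3 →
              α ℚ.* fromℕ (optTotal (ℚ.↧ₙ α)) ℚ.< fromℕ (sptTotal (ℚ.↧ₙ α))
  below-4/3 α@(mkℚ -[1+ _ ] d-1 _) _ =
    scale-< α (optTotal (suc d-1)) (sptTotal (suc d-1)) ℤ.-<+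
  below-4/3 α@(mkℚ (+ k) d-1 _) α<4/3 =
    scale-< α (optTotal d) (sptTotal d)
      (subst₂ ℤ._<_ (sym lhs) (sym rhs) (ℤ.+<+ (ratio-ℕ k d 3k<4d)))
    where
    d : ℕ
    d = suc d-1
    3k<4d : 3 * k < 4 * d
    3k<4d = subst (_< 4 * d) (ℕP.*-comm k 3) (ℤP.drop‿+<+
      (subst₂ ℤ._<_ (sym (ℤP.pos-* k 3)) (sym (ℤP.pos-* 4 d)) (ℚP.drop-*<* α<4/3)))
    lhs : (+ k ℤ.* + optTotal d) ℤ.* + 1 ≡ + (k * optTotal d)
    lhs = trans (ℤP.*-identityʳ _) (sym (ℤP.pos-* k (optTotal d)))
    rhs : + sptTotal d ℤ.* + (d * 1) ≡ + (sptTotal d * d)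
    rhs = trans (sym (ℤP.pos-* (sptTotal d) (d * 1)))
                (cong (λ e → + (sptTotal d * e)) (ℕP.*-identityʳ d))

  by-enumeration : {P : Fin 6 → Set} (P? : Decidable P) → {True (FP.all? P?)} → ∀ p → P p
  by-enumeration P? {holds} = toWitness holds

  radix-< : ∀ m {b b′ u} k → b < b′ → u < m → b * m + u < b′ * m + k
  radix-< m {b} {b′} {u} k b<b′ u<m = begin-strict
    b * m + u   <⟨ ℕP.+-monoʳ-< (b * m) u<m ⟩
    b * m + m   ≡⟨ ℕP.+-comm (b * m) m ⟩
    suc b * m   ≤⟨ ℕP.*-monoˡ-≤ m b<b′ ⟩
    b′ * m      ≤⟨ ℕP.m≤m+n (b′ * m) k ⟩
    b′ * m + k  ∎
    where open ℕP.≤-Reasoning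

  radix-<-inv : ∀ m {b b′ u u′} → u′ < m → b * m + u < b′ * m + u′ → b < b′ ⊎ (b ≡ b′ × u < u′)
  radix-<-inv m {b} {b′} {u} u′<m lt with ℕP.<-cmp b b′
  ... | tri< b<b′ _ _ = inj₁ b<b′
  ... | tri≈ _ refl _ = inj₂ (refl , ℕP.+-cancelˡ-< (b * m) _ _ lt)
  ... | tri> _ _ b′<b = ⊥-elim (ℕP.<-asym lt (radix-< m u b′<b u′<m))

  -- The jobs of the instance with r blocks are 0 … 12r - 1: job b·6 + p (b < r) is position p
  -- of block b, and job r·6 + i is the i-th job of the chain.
  data Kind : Set where
    block : ℕ → Fin 6 → Kind
    chain : ℕ → Kind

  nextBlock : Kind → Kind
  nextBlock (block b p) = block (suc b) p
  nextBlock (chain i)   = chain i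

  kind : ℕ → ℕ → Kind
  kind zero    x = chain x
  kind (suc r) 0 = block 0 0F
  kind (suc r) 1 = block 0 1F
  kind (suc r) 2 = block 0 2F
  kind (suc r) 3 = block 0 3F
  kind (suc r) 4 = block 0 4F
  kind (suc r) 5 = block 0 5F
  kind (suc r) (suc (suc (suc (suc (suc (suc x)))))) = nextBlock (kind r x)

  kind-block : ∀ {r b} (p : Fin 6) → b < r → kind r (b * 6 + toℕ p) ≡ block b p
  kind-block {suc r} {zero}  0F _ = refl
  kind-block {suc r} {zero}  1F _ = refl
  kind-block {suc r} {zero}  2F _ = refl
  kind-block {suc r} {zero}  3F _ = refl
  kind-block {suc r} {zero}  4F _ = refl
  kind-block {suc r} {zero}  5F _ = refl
  kind-block {suc r} {suc b} p (s≤s b<r) = cong nextBlock (kind-block p b<r)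

  kind-chain : ∀ r i → kind r (r * 6 + i) ≡ chain i
  kind-chain zero    i = refl
  kind-chain (suc r) i = cong nextBlock (kind-chain r i)

  data JobView (r x : ℕ) : Set where
    inBlock : ∀ b (p : Fin 6) → b < r → x ≡ b * 6 + toℕ p → JobView r x
    inChain : ∀ i → x ≡ r * 6 + i → JobView r x

  view : ∀ r x → JobView r x
  view zero    x = inChain x refl
  view (suc r) 0 = inBlock 0 0F (s≤s z≤n) refl
  view (suc r) 1 = inBlock 0 1F (s≤s z≤n) refl
  view (suc r) 2 = inBlock 0 2F (s≤s z≤n) refl
  view (suc r) 3 = inBlock 0 3F (s≤s z≤n) refl
  view (suc r) 4 = inBlock 0 4F (s≤s z≤n) refl
  view (suc r) 5 = inBlock 0 5F (s≤s z≤n) refl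
  view (suc r) (suc (suc (suc (suc (suc (suc x)))))) with view r x
  ... | inBlock b p b<r refl = inBlock (suc b) p (s≤s b<r) refl
  ... | inChain i refl       = inChain i refl

  block<chain : ∀ {r b} (p : Fin 6) i → b < r → b * 6 + toℕ p < r * 6 + i
  block<chain p i b<r = radix-< 6 i b<r (FP.toℕ<n p)

  resourceK : Kind → ℕ
  resourceK (block b p) = suc (b * 6 + toℕ p)
  resourceK (chain i)   = 0

  resourceOf : ℕ → ℕ → ℕ
  resourceOf r x = resourceK (kind r x)

  shared-resource : ∀ r {x y} → x < y → resourceOf r x ≡ resourceOf r y →
                    ∃₂ λ i j → x ≡ r * 6 + i × y ≡ r * 6 + j × i < j
  shared-resource r {x} {y} x<y same with view r x | view r y
  ... | inBlock b p b<r refl | inBlock b′ p′ b′<r refl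
    rewrite kind-block p b<r | kind-block p′ b′<r =
      ⊥-elim (ℕP.<-irrefl (ℕP.suc-injective same) x<y)
  ... | inBlock b p b<r refl | inChain j refl
    rewrite kind-block p b<r | kind-chain r j with () ← same
  ... | inChain i refl | inBlock b′ p′ b′<r refl
    rewrite kind-chain r i | kind-block p′ b′<r with () ← same
  ... | inChain i refl | inChain j refl = i , j , refl , refl , ℕP.+-cancelˡ-< (r * 6) i j x<y

  instanceOf : ℕ → Instance
  instanceOf r = record
    { m     = 3
    ; m≥1   = s≤s z≤n
    ; n     = r * 6 + r * 6
    ; p     = λ _ → fromℕ 1
    ; p-pos = λ _ → fromℕ-mono-< (s≤s z≤n)
    ; res   = λ j → resourceOf r (toℕ j)
    }

  -- A layout runs position p of block b at time b · width + row p on machine `machine p`, and the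
  -- i-th chain job at time chainStart + i on machine 0.  Positions sharing a machine get distinct
  -- rows in index order, and machine 0 is left to the chain once it starts.
  record Layout (r : ℕ) : Set where
    field
      width         : ℕ
      row           : Fin 6 → ℕ
      machine       : Fin 6 → Fin 3
      chainStart    : ℕ
      row<width     : ∀ p → row p < width
      rows-separate : ∀ p q → toℕ p < toℕ q → machine p ≡ machine q → row p < row q
      chain-after   : ∀ p → machine p ≡ 0F → r * width ≤ chainStart

    rowSum : ℕ
    rowSum = row 0F + (row 1F + (row 2F + (row 3F + (row 4F + row 5F))))

  module LayoutSchedule {r : ℕ} (L : Layout r) where
    open Layout L

    startK : Kind → ℕ
    startK (block b p) = b * width + row p
    startK (chain i)   = chainStart + i

    machineK : Kind → Fin 3
    machineK (block b p) = machine p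
    machineK (chain i)   = 0F

    startOf : ℕ → ℕ
    startOf x = startK (kind r x)

    machineOf : ℕ → Fin 3
    machineOf x = machineK (kind r x)

    start-block : ∀ {b} (p : Fin 6) → b < r → startOf (b * 6 + toℕ p) ≡ b * width + row p
    start-block p b<r = cong startK (kind-block p b<r)

    machine-block : ∀ {b} (p : Fin 6) → b < r → machineOf (b * 6 + toℕ p) ≡ machine p
    machine-block p b<r = cong machineK (kind-block p b<r)

    start-chain : ∀ i → startOf (r * 6 + i) ≡ chainStart + i
    start-chain i = cong startK (kind-chain r i)

    machine-order : ∀ {x y} → x < y → machineOf x ≡ machineOf y → startOf x < startOf y
    machine-order {x} {y} x<y same with view r x | view r y
    ... | inBlock b p b<r refl | inBlock b′ p′ b′<r refl
      rewrite kind-block p b<r | kind-block p′ b′<r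
      with radix-<-inv 6 {b} {b′} (FP.toℕ<n p′) x<y
    ... | inj₁ b<b′          = radix-< width (row p′) b<b′ (row<width p)
    ... | inj₂ (refl , p<p′) = ℕP.+-monoʳ-< (b * width) (rows-separate p p′ p<p′ same)
    machine-order {x} {y} x<y same | inBlock b p b<r refl | inChain j refl
      rewrite kind-block p b<r | kind-chain r j = begin-strict
        b * width + row p  <⟨ radix-< width 0 b<r (row<width p) ⟩
        r * width + 0      ≡⟨ ℕP.+-identityʳ (r * width) ⟩
        r * width          ≤⟨ chain-after p same ⟩
        chainStart         ≤⟨ ℕP.m≤m+n chainStart j ⟩
        chainStart + j     ∎
      where open ℕP.≤-Reasoning
    machine-order {x} {y} x<y same | inChain i refl | inBlock b′ p′ b′<r refl =
      ⊥-elim (ℕP.<-asym x<y (block<chain p′ i b′<r))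
    machine-order {x} {y} x<y same | inChain i refl | inChain j refl
      rewrite kind-chain r i | kind-chain r j =
        ℕP.+-monoʳ-< chainStart (ℕP.+-cancelˡ-< (r * 6) i j x<y)

    resource-order : ∀ {x y} → x < y → resourceOf r x ≡ resourceOf r y → startOf x < startOf y
    resource-order x<y same with shared-resource r x<y same
    ... | i , j , refl , refl , i<j rewrite start-chain i | start-chain j =
      ℕP.+-monoʳ-< chainStart i<j

    resource-machine : ∀ {x y} → x < y → resourceOf r x ≡ resourceOf r y → machineOf y ≡ machineOf x
    resource-machine x<y same with shared-resource r x<y same
    ... | i , j , refl , refl , _ =
      trans (cong machineK (kind-chain r j)) (sym (cong machineK (kind-chain r i)))

    N : ℕ
    N = r * 6 + r * 6

    schedule : Schedule (instanceOf r)
    schedule = mkSchedule (λ j → machineOf (toℕ j)) (λ j → fromℕ (startOf (toℕ j)))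

    completion : ∀ j → C schedule j ≡ fromℕ (suc (startOf (toℕ j)))
    completion j = trans (sym (fromℕ-+ (startOf (toℕ j)) 1)) (cong fromℕ (ℕP.+-comm _ 1))

    -- Unit jobs at integral times: if conflicting jobs start strictly later in index order, the
    -- processing intervals of any two distinct conflicting jobs are disjoint.
    ordered⇒disjoint : (_~_ : ℕ → ℕ → Set) → (∀ {x y} → x < y → x ~ y → startOf x < startOf y) →
                       ∀ j k → j ≢ k → toℕ j ~ toℕ k → toℕ k ~ toℕ j →
                       C schedule j ℚ.≤ start schedule k ⊎ C schedule k ℚ.≤ start schedule j
    ordered⇒disjoint _~_ ordered j k j≢k j~k k~j with ℕP.<-cmp (toℕ j) (toℕ k)
    ... | tri< j<k _ _ = inj₁ (subst (ℚ._≤ _) (sym (completion j)) (fromℕ-mono-≤ (ordered j<k j~k)))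
    ... | tri≈ _ j≡k _ = ⊥-elim (j≢k (FP.toℕ-injective j≡k))
    ... | tri> _ _ k<j = inj₂ (subst (ℚ._≤ _) (sym (completion k)) (fromℕ-mono-≤ (ordered k<j k~j)))

    feasible : Feasible schedule
    feasible = (λ _ → fromℕ-mono-≤ z≤n)
      , (λ j k j≢k same → ordered⇒disjoint (λ x y → machineOf x ≡ machineOf y)
                            machine-order j k j≢k same (sym same))
      , (λ j k j≢k same → ordered⇒disjoint (λ x y → resourceOf r x ≡ resourceOf r y)
                            resource-order j k j≢k same (sym same))

    cost-schedule : cost schedule ≡ fromℕ (∑ N (λ x → suc (startOf x)))
    cost-schedule = trans (cong (foldr ℚ._+_ 0ℚ) (LP.map-tabulate (λ j → j) (C schedule)))
                          (foldr-fromℕ N _ _ completion)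

    block-sum : ∀ {b} → b < r → ∑ 6 (λ j → suc (startOf (b * 6 + j))) ≡ (6 + rowSum) + 6 * width * b
    block-sum {b} b<r
      rewrite start-block 0F b<r | start-block 1F b<r | start-block 2F b<r
            | start-block 3F b<r | start-block 4F b<r | start-block 5F b<r
      = six-rows b width (row 0F) (row 1F) (row 2F) (row 3F) (row 4F) (row 5F)
      where
      six-rows : ∀ b w r₀ r₁ r₂ r₃ r₄ r₅ →
        suc (b * w + r₀) + (suc (b * w + r₁) + (suc (b * w + r₂) + (suc (b * w + r₃) +
          (suc (b * w + r₄) + (suc (b * w + r₅) + 0)))))
        ≡ (6 + (r₀ + (r₁ + (r₂ + (r₃ + (r₄ + r₅)))))) + 6 * w * b
      six-rows = solve-∀

    -- Total completion time of a layout: blocks and chain are two arithmetic progressions.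
    total-start : 2 * ∑ N (λ x → suc (startOf x)) + (r * (6 * width) + r * 6 * 1)
                ≡ r * (2 * (6 + rowSum) + r * (6 * width))
                  + r * 6 * (2 * suc chainStart + r * 6 * 1)
    total-start = begin
      2 * ∑ N f + (u + v)              ≡⟨ cong (λ s → 2 * s + (u + v)) (∑-split (r * 6) (r * 6) f) ⟩
      2 * (B + K) + (u + v)            ≡⟨ regroup B K u v ⟩
      (2 * B + u) + (2 * K + v)        ≡⟨ cong₂ _+_ blocks chains ⟩
      r * (2 * (6 + rowSum) + r * (6 * width)) + r * 6 * (2 * suc chainStart + r * 6 * 1) ∎
      where
      open ≡-Reasoning
      f : ℕ → ℕ
      f x = suc (startOf x)
      B K u v : ℕ
      B = ∑ (r * 6) f
      K = ∑ (r * 6) (λ i → f (r * 6 + i))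
      u = r * (6 * width)
      v = r * 6 * 1
      regroup : ∀ B K u v → 2 * (B + K) + (u + v) ≡ (2 * B + u) + (2 * K + v)
      regroup = solve-∀
      blocks : 2 * B + u ≡ r * (2 * (6 + rowSum) + r * (6 * width))
      blocks = trans (cong (λ s → 2 * s + u)
                       (trans (∑-blocks r 6 f) (∑-cong r (λ b b<r → block-sum b<r))))
                     (∑-arith r (6 + rowSum) (6 * width))
      chains : 2 * K + v ≡ r * 6 * (2 * suc chainStart + r * 6 * 1)
      chains = trans (cong (λ s → 2 * s + v) (∑-cong (r * 6) (λ i _ →
                      cong suc (trans (start-chain i)
                        (cong (λ s → chainStart + s) (sym (ℕP.*-identityˡ i)))))))
                    (∑-arith (r * 6) (suc chainStart) 1)

  -- The SPT-available schedule: block b occupies times 2b and 2b + 1 on all three machines.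
  sptRow : Fin 6 → ℕ
  sptRow 0F = 0
  sptRow 1F = 0
  sptRow 2F = 0
  sptRow 3F = 1
  sptRow 4F = 1
  sptRow 5F = 1

  sptMachine : Fin 6 → Fin 3
  sptMachine 0F = 0F
  sptMachine 1F = 1F
  sptMachine 2F = 2F
  sptMachine 3F = 0F
  sptMachine 4F = 1F
  sptMachine 5F = 2F

  -- The better schedule: block b occupies times 3b, 3b + 1, 3b + 2 on machines 1 and 2.
  optRow : Fin 6 → ℕ
  optRow 0F = 0
  optRow 1F = 0
  optRow 2F = 1
  optRow 3F = 1
  optRow 4F = 2
  optRow 5F = 2

  optMachine : Fin 6 → Fin 3
  optMachine 0F = 1F
  optMachine 1F = 2F
  optMachine 2F = 1F
  optMachine 3F = 2F
  optMachine 4F = 1F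
  optMachine 5F = 2F

  sptLayout : ∀ r → Layout r
  sptLayout r = record
    { width         = 2
    ; row           = sptRow
    ; machine       = sptMachine
    ; chainStart    = r * 2
    ; row<width     = by-enumeration (λ p → sptRow p ℕ.<? 2)
    ; rows-separate = by-enumeration (λ p → FP.all? λ q → (toℕ p ℕ.<? toℕ q) →-dec
                        ((sptMachine p FP.≟ sptMachine q) →-dec (sptRow p ℕ.<? sptRow q)))
    ; chain-after   = λ _ _ → ℕP.≤-refl
    }

  optLayout : ∀ r → Layout r
  optLayout r = record
    { width         = 3
    ; row           = optRow
    ; machine       = optMachine
    ; chainStart    = 0
    ; row<width     = by-enumeration (λ p → optRow p ℕ.<? 3)
    ; rows-separate = by-enumeration (λ p → FP.all? λ q → (toℕ p ℕ.<? toℕ q) →-dec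
                        ((optMachine p FP.≟ optMachine q) →-dec (optRow p ℕ.<? optRow q)))
    ; chain-after   = λ p on-0 → ⊥-elim (off-machine-0 p on-0)
    }
    where
    off-machine-0 : ∀ p → ¬ optMachine p ≡ 0F
    off-machine-0 = by-enumeration (λ p → ¬? (optMachine p FP.≟ 0F))

  -- Totals are computed doubled (Gauss); this halves them again.
  half : ∀ {a b} e → 2 * a + e ≡ 2 * b + e → a ≡ b
  half e eq = ℕP.*-cancelˡ-≡ _ _ 2 (ℕP.+-cancelʳ-≡ e _ _ eq)

  spt-cost : ∀ r → cost (LayoutSchedule.schedule (sptLayout r)) ≡ fromℕ (sptTotal r)
  spt-cost r = trans SPT.cost-schedule (cong fromℕ (half _ (trans SPT.total-start (closed r))))
    where
    module SPT = LayoutSchedule (sptLayout r)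
    closed : ∀ r → r * (2 * 9 + r * 12) + r * 6 * (2 * suc (r * 2) + r * 6 * 1)
                 ≡ 2 * (36 * r * r + 6 * r) + (r * 12 + r * 6 * 1)
    closed = solve-∀

  opt-cost : ∀ r → cost (LayoutSchedule.schedule (optLayout r)) ≡ fromℕ (optTotal r)
  opt-cost r = trans OPT.cost-schedule (cong fromℕ (half _ (trans OPT.total-start (closed r))))
    where
    module OPT = LayoutSchedule (optLayout r)
    closed : ∀ r → r * (2 * 12 + r * 18) + r * 6 * (2 * 1 + r * 6 * 1)
                 ≡ 2 * (27 * r * r + 6 * r) + (r * 18 + r * 6 * 1)
    closed = solve-∀

  module SPTRun (r : ℕ) where
    open LayoutSchedule (sptLayout r)

    AllBusy : ℕ → Set
    AllBusy c = ∀ (i : Fin 3) → ∃ λ x → x ≤ c × machineOf x ≡ i × startOf x ≡ startOf c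

    RestBlocked : ℕ → Set
    RestBlocked c = ∀ y → c < y → resourceOf r y ≡ resourceOf r c

    data NextStart (c : ℕ) : Set where
      sameTime : startOf (suc c) ≡ startOf c → NextStart c
      nextTime : startOf (suc c) ≡ suc (startOf c) → AllBusy c ⊎ RestBlocked c → NextStart c

    start-succ : ∀ {b} (p q : Fin 6) → suc (toℕ p) ≡ toℕ q → b < r →
                 startOf (suc (b * 6 + toℕ p)) ≡ b * 2 + sptRow q
    start-succ {b} p q p+1≡q b<r =
      trans (cong startOf (trans (sym (ℕP.+-suc (b * 6) (toℕ p))) (cong (λ s → b * 6 + s) p+1≡q)))
            (start-block q b<r)

    row-start : ∀ {b} → b ≤ r → startOf (b * 6 + 0) ≡ b * 2 + 0
    row-start {b} b≤r with ℕP.m≤n⇒m<n∨m≡n b≤r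
    ... | inj₁ b<r  = start-block 0F b<r
    ... | inj₂ refl = start-chain 0

    block-busy : ∀ {b} (p : Fin 6) → b < r →
                 (∀ i → ∃ λ q → toℕ q ≤ toℕ p × sptMachine q ≡ i × sptRow q ≡ sptRow p) →
                 AllBusy (b * 6 + toℕ p)
    block-busy {b} p b<r witness i with witness i
    ... | q , q≤p , on-i , same-row =
      b * 6 + toℕ q , ℕP.+-monoʳ-≤ (b * 6) q≤p , trans (machine-block q b<r) on-i ,
      trans (start-block q b<r) (trans (cong (λ s → b * 2 + s) same-row) (sym (start-block p b<r)))

    -- Positions 0, 1, 3, 4 are followed within the same row; after positions 2 and 5 a row is
    -- full; in the chain every later job waits for the shared resource.
    next-start : ∀ c → NextStart c
    next-start c with view r c
    ... | inBlock b 0F b<r refl = sameTime (trans (start-succ 0F 1F refl b<r) (sym (start-block 0F b<r)))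
    ... | inBlock b 1F b<r refl = sameTime (trans (start-succ 1F 2F refl b<r) (sym (start-block 1F b<r)))
    ... | inBlock b 3F b<r refl = sameTime (trans (start-succ 3F 4F refl b<r) (sym (start-block 3F b<r)))
    ... | inBlock b 4F b<r refl = sameTime (trans (start-succ 4F 5F refl b<r) (sym (start-block 4F b<r)))
    ... | inBlock b 2F b<r refl =
      nextTime (trans (start-succ 2F 3F refl b<r)
                      (trans (ℕP.+-suc (b * 2) 0) (cong suc (sym (start-block 2F b<r)))))
               (inj₁ (block-busy 2F b<r λ { 0F → 0F , z≤n , refl , refl
                                           ; 1F → 1F , s≤s z≤n , refl , refl
                                           ; 2F → 2F , ℕP.≤-refl , refl , refl }))
    ... | inBlock b 5F b<r refl =
      nextTime (trans (cong startOf (first-of-next b)) (trans next-row (cong suc (sym (start-block 5F b<r)))))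
               (inj₁ (block-busy 5F b<r λ { 0F → 3F , ℕP.≤-pred (FP.toℕ<n 3F) , refl , refl
                                           ; 1F → 4F , ℕP.≤-pred (FP.toℕ<n 4F) , refl , refl
                                           ; 2F → 5F , ℕP.≤-pred (FP.toℕ<n 5F) , refl , refl }))
      where
      first-of-next : ∀ b → suc (b * 6 + 5) ≡ suc b * 6 + 0
      first-of-next = solve-∀
      two-rows : ∀ b → suc b * 2 + 0 ≡ suc (b * 2 + 1)
      two-rows = solve-∀
      next-row : startOf (suc b * 6 + 0) ≡ suc (b * 2 + 1)
      next-row = trans (row-start b<r) (two-rows b)
    ... | inChain i refl =
      nextTime (trans (cong startOf (sym (ℕP.+-suc (r * 6) i)))
                      (trans (start-chain (suc i))
                        (trans (ℕP.+-suc (r * 2) i) (cong suc (sym (start-chain i))))))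
               (inj₂ rest-blocked)
      where
      rest-blocked : RestBlocked (r * 6 + i)
      rest-blocked y c<y with view r y
      ... | inBlock b′ p′ b′<r refl = ⊥-elim (ℕP.<-asym c<y (block<chain p′ i b′<r))
      ... | inChain j refl = trans (cong resourceK (kind-chain r j)) (sym (cong resourceK (kind-chain r i)))

    -- Simulation invariants: the remaining list is jobs c, c+1, … in order, and the started
    -- jobs are exactly those with index below c.
    data Consecutive : ℕ → List (Fin N) → Set where
      done : ∀ {c} → Consecutive c []
      next : ∀ {c j L} → toℕ j ≡ c → Consecutive (suc c) L → Consecutive c (j ∷ L)

    consecutive-≥ : ∀ {c L} → Consecutive c L → All (λ k → c ≤ toℕ k) L
    consecutive-≥ done             = []
    consecutive-≥ (next refl rest) =
      ℕP.≤-refl ∷ All.map (ℕP.≤-trans (ℕP.n≤1+n _)) (consecutive-≥ rest)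

    tabulate-consecutive : ∀ k c (f : Fin k → Fin N) → (∀ i → toℕ (f i) ≡ c + toℕ i) →
                           Consecutive c (tabulate f)
    tabulate-consecutive zero    c f f≗ = done
    tabulate-consecutive (suc k) c f f≗ =
      next (trans (f≗ F.zero) (ℕP.+-identityʳ c))
           (tabulate-consecutive k (suc c) (λ i → f (F.suc i))
              (λ i → trans (f≗ (F.suc i)) (ℕP.+-suc c (toℕ i))))

    Started : ℕ → List (Fin N) → Set
    Started c D = (∀ k → k ∈ D → toℕ k < c) × (∀ x → x < c → ∃ λ k → k ∈ D × toℕ k ≡ x)

    started-none : Started 0 []
    started-none = (λ _ ()) , (λ _ ())

    started-one-more : ∀ {c j D} → toℕ j ≡ c → Started c D → Started (suc c) (j ∷ D)
    started-one-more {c} {j} {D} refl (below , complete) = below′ , complete′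
      where
      below′ : ∀ k → k ∈ j ∷ D → toℕ k < suc c
      below′ k (here refl)  = ℕP.≤-refl
      below′ k (there k∈D) = ℕP.m≤n⇒m≤1+n (below k k∈D)
      complete′ : ∀ x → x < suc c → ∃ λ k → k ∈ j ∷ D × toℕ k ≡ x
      complete′ x (s≤s x≤c) with ℕP.m≤n⇒m<n∨m≡n x≤c
      ... | inj₁ x<c  = let (k , k∈D , k≡x) = complete x x<c in k , there k∈D , k≡x
      ... | inj₂ refl = j , here refl , refl

    -- With unit jobs at integral times, a job is running at time s exactly when it started at s.
    finished-before : ∀ k {c} → suc (startOf (toℕ k)) ≤ startOf c →
                      ¬ Running schedule k (fromℕ (startOf c))
    finished-before k done-by (_ , t<C) =
      ℕP.<-irrefl refl (ℕP.<-≤-trans (fromℕ-cancel-< (subst (_ ℚ.<_) (completion k) t<C)) done-by)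

    running-at : ∀ k {a} → startOf (toℕ k) ≡ a → Running schedule k (fromℕ a)
    running-at k {a} refl =
      fromℕ-mono-≤ ℕP.≤-refl , subst (fromℕ a ℚ.<_) (sym (completion k)) (fromℕ-mono-< ℕP.≤-refl)

    -- Job c is the first job of the remaining list, its resource and its machine are free, and
    -- it takes over the machine of any earlier job of its resource.
    start-step : ∀ {c j L D} → toℕ j ≡ c → Started c D →
                 Step schedule (fromℕ (startOf c) , j ∷ L , D) (fromℕ (startOf c) , L , j ∷ D)
    start-step {c} {j} {L} {D} refl (below , _) =
      startJob (here resource-free) (machine-idle , same-machine) refl refl
      where
      t : ℚ
      t = fromℕ (startOf c)
      resource-free : ResourceFree schedule D t j
      resource-free k k∈D same = finished-before k (resource-order (below k k∈D) same)
      machine-idle : MachineIdle schedule D t (machineOf c)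
      machine-idle k k∈D same = finished-before k (machine-order (below k k∈D) same)
      same-machine : ∀ k → k ∈ D → resourceOf r (toℕ k) ≡ resourceOf r c → C schedule k ≡ t →
                     MachineIdle schedule D t (machineOf (toℕ k)) → machineOf c ≡ machineOf (toℕ k)
      same-machine k k∈D same _ _ = resource-machine (below k k∈D) same

    advance-step : ∀ {c j L D} → toℕ j ≡ c → Started (suc c) (j ∷ D) → L ≢ [] → Consecutive (suc c) L →
                   startOf (suc c) ≡ suc (startOf c) → AllBusy c ⊎ RestBlocked c →
                   Step schedule (fromℕ (startOf c) , L , j ∷ D) (fromℕ (startOf (suc c)) , L , j ∷ D)
    advance-step {c} {j} {L} {D} refl (_ , complete) L≢[] rest later why =
      advance L≢[] (no-start why) (fromℕ-mono-< (ℕP.≤-reflexive (sym later))) (here refl)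
              (trans (completion j) (cong fromℕ (sym later))) separated
      where
      no-start : AllBusy c ⊎ RestBlocked c → NoStart schedule (j ∷ D) (fromℕ (startOf c)) L
      no-start (inj₁ busy) = inj₁ λ i idle →
        let (x , x≤c , on-i , at-c) = busy i
            (k , k∈D , k≡x)         = complete x (s≤s x≤c)
        in idle k k∈D (trans (cong machineOf k≡x) on-i) (running-at k (trans (cong startOf k≡x) at-c))
      no-start (inj₂ blocked) = inj₂ (All.map (λ {k} c<k free →
          free j (here refl) (sym (blocked (toℕ k) c<k)) (running-at j refl)) (consecutive-≥ rest))
      separated : ∀ l → l ∈ j ∷ D →
                  C schedule l ℚ.≤ fromℕ (startOf c) ⊎ fromℕ (startOf (suc c)) ℚ.≤ C schedule l
      separated l _ with suc (startOf (toℕ l)) ℕ.≤? startOf c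
      ... | yes ended   = inj₁ (subst (ℚ._≤ _) (sym (completion l)) (fromℕ-mono-≤ ended))
      ... | no  running = inj₂ (subst₂ ℚ._≤_ (cong fromℕ (sym later)) (sym (completion l))
                                              (fromℕ-mono-≤ (ℕP.≰⇒> running)))

    run : ∀ c L D → Consecutive c L → Started c D →
          ∃ λ t → ∃ λ D′ → Star (Step schedule) (fromℕ (startOf c) , L , D) (t , [] , D′)
    run c []           D done            started = _ , D , ε
    run c (j ∷ [])     D (next j≡c done) started = _ , j ∷ D , start-step j≡c started ◅ ε
    run c (j ∷ j′ ∷ L) D (next j≡c rest) started
      with next-start c | run (suc c) (j′ ∷ L) (j ∷ D) rest (started-one-more j≡c started)
    ... | sameTime same | t , D′ , steps =
      t , D′ , start-step j≡c started ◅
        subst (λ s → Star (Step schedule) (fromℕ s , j′ ∷ L , j ∷ D) (t , [] , D′)) same steps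
    ... | nextTime later why | t , D′ , steps =
      t , D′ , start-step j≡c started ◅
        advance-step j≡c (started-one-more j≡c started) (λ ()) rest later why ◅ steps

    -- All processing times are equal, so any list is ordered shortest first.
    unit-times : ∀ (L : List (Fin N)) → AllPairs (λ a b → fromℕ 1 ℚ.≤ fromℕ 1) L
    unit-times []      = []
    unit-times (_ ∷ L) = All.tabulate (λ _ → fromℕ-mono-≤ ℕP.≤-refl) ∷ unit-times L

    spt-available : SPTAvailable schedule
    spt-available
      with run 0 (allFin N) [] (tabulate-consecutive N 0 (λ j → j) (λ _ → refl)) started-none
    ... | t , D , steps = allFin N , ↭-refl , unit-times (allFin N) , t , D ,
      subst (λ s → Star (Step schedule) (fromℕ s , allFin N , []) (t , [] , D)) (row-start z≤n) steps

open import Defs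
open import Data.Integer using (+_)
open import Data.Rational using (ℚ; _/_; _*_; _<_; ↧ₙ_)
open import Data.Nat using (ℕ)
open import Data.Product using (Σ; _×_; _,_)
open import Relation.Binary.PropositionalEquality using (subst₂; sym)
open SPTLowerBound

mainTheorem7 : (α : ℚ) → α < + 4 / 3 →
    Σ Instance λ I → Σ (Schedule I) λ S → SPTAvailable S ×
      Σ (Schedule I) λ S* → Feasible S* × α * cost S* < cost S
mainTheorem7 α α<4/3 =
  instanceOf r , SPT.schedule , SPTRun.spt-available r , OPT.schedule , OPT.feasible ,
  subst₂ (λ a b → α * a < b) (sym (opt-cost r)) (sym (spt-cost r)) (below-4/3 α α<4/3)
  where
  r : ℕ
  r = ↧ₙ α
  module SPT = LayoutSchedule (sptLayout r)
  module OPT = LayoutSchedule (optLayout r)
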